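{- Let $\Pi$ be an $\mathscr{R}$-derivation (typing a $\lambda$-term). Then there is an $\mathtt{S}_\mathtt{h}$-derivation $P$ collapsing on $\Pi$.
   Context: $\mathtt{S}$-types and sequence types are given by mutual coinduction: $T::=o\in\mathscr{O}\mid F\rightarrow T$, $F::=(k\cdot S_k)_{k\in K}$ with $K\subseteq\mathbb{N}\setminus\{0,1\}$ countable. Supports: $\mathrm{supp}(o)=\{\varepsilon\}$, $\mathrm{supp}(F\rightarrow T)=\{\varepsilon\}\cup\mathrm{supp}(F)\cup1\cdot\mathrm{supp}(T)$, $\mathrm{supp}((k\cdot S_k)_{k\in K})=\bigcup_k k\cdot\mathrm{supp}(S_k)$. $U_1\equiv U_2$ means there is a label-preserving, prefix-monotone, length-preserving bijection $\phi:\mathrm{supp}(U_1)\to\mathrm{supp}(U_2)$ with $\phi(a\cdot k)=\phi(a)\cdot k$ for $k\in\{0,1\}$ (equivalently for sequence types: a bijection $\rho:K\to K'$ with $S_k\equiv S'_{\rho(k)}$). $\mathtt{S}$-contexts map variables to sequence types, with partial pointwise disjoint union $\uplus$ (defined only when track sets are disjoint). System $\mathtt{S}_\mathtt{h}$: (ax) $x:(k\cdot T)\vdash x:T$ for $k\geq2$; (abs) from $C;x:(S_k)_{k\in K}\vdash t:T$ infer $C\vdash\lambda x.t:(S_k)_{k\in K}\rightarrow T$; (app$_\mathtt{h}$) from $C\vdash t:(S_k)_{k\in K}\rightarrow T$ and $(D_k\vdash u:S'_k)_{k\in K'}$ with $(S_k)_{k\in K}\equiv(S'_k)_{k\in K'}$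 infer $C\uplus(\biguplus_{k\in K'}D_k)\vdash t\,u:T$ (union defined). $\mathscr{R}$-types are $\equiv$-classes of $\mathtt{S}$-types; multiset types are countable multisets of $\mathscr{R}$-types; collapse: $\overline{T}$ is the class of $T$, $\overline{(k\cdot S_k)_{k\in K}}=[\overline{S_k}]_{k\in K}$, and $\overline{F\rightarrow T}=\overline{F}\rightarrow\overline{T}$. $\mathscr{R}$-contexts map variables to multiset types, $+$ is pointwise multiset sum, $\Gamma;\Delta$ is $+$ with disjoint domains. $\mathscr{R}$ rules: (ax) $x:[\tau]\vdash x:\tau$; (abs) from $\Gamma;x:[\sigma_i]_{i\in I}\vdash t:\tau$ infer $\Gamma\vdash\lambda x.t:[\sigma_i]_{i\in I}\rightarrow\tau$; (app) from $\Gamma\vdash t:[\sigma_i]_{i\in I}\rightarrow\tau$ and $(\Delta_i\vdash u:\sigma_i)_{i\in I}$ infer $\Gamma+\sum_i\Delta_i\vdash t\,u:\tau$ ($I$ countable). The collapse of an $\mathtt{S}_\mathtt{h}$-derivation is the $\mathscr{R}$-derivation of the same shape obtained by replacing each judgment $C\vdash u:T$ by $\overline{C}\vdash u:\overline{T}$ (pointwise on contexts) and regarding the argument premises indexed by tracks as a family. -}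

module Defs where

open import Data.Nat using (ℕ; zero; suc; _≤_)
open import Data.List using (List; []; _∷_; _++_; length)
open import Data.Maybe using (Maybe; just; nothing; Is-just; to-witness)
open import Data.Maybe.Relation.Unary.Any using (just)
open import Data.Product using (Σ; _,_; proj₁; proj₂)
open import Data.Sum using (_⊎_; inj₁; inj₂)
open import Data.Unit using (⊤; tt)
open import Data.Empty using (⊥)
open import Relation.Binary.PropositionalEquality using (_≡_; _≢_; refl)

Var : Set
Var = ℕ

data Term : Set where
  var : Var → Term
  lam : Var → Term → Term
  app : Term → Term → Term

-- Countable families: a partial enumeration ℕ → Maybe A.
-- Its index set Dom F ⊆ ℕ is countable.

Fam : Set → Set
Fam A = ℕ → Maybe A

Dom : {A : Set} → Fam A → Set
Dom F = Σ ℕ (λ n → Is-just (F n))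

elt : {A : Set} (F : Fam A) → Dom F → A
elt F (n , p) = to-witness p

record Bij (I J : Set) : Set where
  field
    to      : I → J
    from    : J → I
    from∘to : ∀ i → from (to i) ≡ i
    to∘from : ∀ j → to (from j) ≡ j

record Match {I J A B : Set} (R : A → B → Set) (f : I → A) (g : J → B) : Set where
  field
    bij : Bij I J
    rel : ∀ i → R (f i) (g (Bij.to bij i))

-- Positions (finite words over ℕ, a · k  is  a ++ k ∷ [])

Pos : Set
Pos = List ℕ

_⊑_ : Pos → Pos → Set
a ⊑ b = Σ Pos (λ c → a ++ c ≡ b)

module _ (O : Set) where

  data Label : Set where
    atomL : O → Label
    arrL  : Label

  Tree : Set
  Tree = Pos → Maybe Label

  TSupp : Tree → Set
  TSupp t = Σ Pos (λ a → Is-just (t a))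

  pos : {t : Tree} → TSupp t → Pos
  pos = proj₁

  -- The paper's ≡ on (S-types and sequence types), via supports:
  -- a label-preserving, prefix-monotone, length-preserving bijection
  -- φ between the supports with φ(a·k) = φ(a)·k for k ∈ {0,1}.
  record _≡ᵗ_ (t u : Tree) : Set where
    field
      φ       : Bij (TSupp t) (TSupp u)
      label   : ∀ s → u (pos {u} (Bij.to φ s)) ≡ t (pos {t} s)
      mono    : ∀ s s' → pos {t} s ⊑ pos {t} s' →
                pos {u} (Bij.to φ s) ⊑ pos {u} (Bij.to φ s')
      lengthφ : ∀ s → length (pos {u} (Bij.to φ s)) ≡ length (pos {t} s)
      step    : ∀ s s' k → k ≤ 1 → pos {t} s' ≡ pos {t} s ++ k ∷ [] →
                pos {u} (Bij.to φ s') ≡ pos {u} (Bij.to φ s) ++ k ∷ []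

  -- S-types (the coinductive grammar T ::= o | F → T, presented by
  -- their labelled supports): the root is in the support, only
  -- arrow nodes have children, children are at tracks k ≥ 1
  -- (1 = codomain, k ≥ 2 = argument tracks), every arrow node has
  -- a codomain child.

  record IsSTy (t : Tree) : Set where
    field
      root   : Is-just (t [])
      parent : ∀ a k → Is-just (t (a ++ k ∷ [])) → t a ≡ just arrL
      no0    : ∀ a → Is-just (t (a ++ 0 ∷ [])) → ⊥
      cod    : ∀ a → t a ≡ just arrL → Is-just (t (a ++ 1 ∷ []))

  record STy : Set where
    field
      lab : Tree
      wf  : IsSTy lab
  open STy public

  -- A sequence type (k·S_k)_{k∈K}, K ⊆ ℕ∖{0,1}: index n stands for
  -- track n + 2, i.e. K = { n + 2 | F n ≠ nothing }.
  SSeq : Set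
  SSeq = Fam STy

  seqTree : SSeq → Tree
  seqTree F []                  = nothing
  seqTree F (zero ∷ a)          = nothing
  seqTree F (suc zero ∷ a)      = nothing
  seqTree F (suc (suc n) ∷ a) with F n
  ... | just S  = lab S a
  ... | nothing = nothing

  arrTree : SSeq → STy → Tree
  arrTree F T []                  = just arrL
  arrTree F T (zero ∷ a)          = nothing
  arrTree F T (suc zero ∷ a)      = lab T a
  arrTree F T (suc (suc n) ∷ a)   = seqTree F (suc (suc n) ∷ a)

  private
    nj : ∀ {A : Set} → Is-just {A = A} nothing → ⊥
    nj ()

    arrWF : ∀ F T → IsSTy (arrTree F T)
    IsSTy.root (arrWF F T) = just tt
    IsSTy.parent (arrWF F T) [] k p = refl
    IsSTy.parent (arrWF F T) (zero ∷ a) k p = ⊥-e (nj p)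
      where ⊥-e : ⊥ → _
            ⊥-e ()
    IsSTy.parent (arrWF F T) (suc zero ∷ a) k p = IsSTy.parent (wf T) a k p
    IsSTy.parent (arrWF F T) (suc (suc n) ∷ a) k p with F n
    ... | just S  = IsSTy.parent (wf S) a k p
    ... | nothing = ⊥-e (nj p)
      where ⊥-e : ⊥ → _
            ⊥-e ()
    IsSTy.no0 (arrWF F T) [] p = nj p
    IsSTy.no0 (arrWF F T) (zero ∷ a) p = nj p
    IsSTy.no0 (arrWF F T) (suc zero ∷ a) p = IsSTy.no0 (wf T) a p
    IsSTy.no0 (arrWF F T) (suc (suc n) ∷ a) p with F n
    ... | just S  = IsSTy.no0 (wf S) a p
    ... | nothing = nj p
    IsSTy.cod (arrWF F T) [] e = IsSTy.root (wf T)
    IsSTy.cod (arrWF F T) (zero ∷ a) ()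
    IsSTy.cod (arrWF F T) (suc zero ∷ a) e = IsSTy.cod (wf T) a e
    IsSTy.cod (arrWF F T) (suc (suc n) ∷ a) e with F n
    IsSTy.cod (arrWF F T) (suc (suc n) ∷ a) e | just S = IsSTy.cod (wf S) a e
    IsSTy.cod (arrWF F T) (suc (suc n) ∷ a) () | nothing

  mkArr : SSeq → STy → STy
  mkArr F T = record { lab = arrTree F T ; wf = arrWF F T }

  _≈_ : STy → STy → Set
  T ≈ U = lab T ≡ᵗ lab U

  _≈seq_ : SSeq → SSeq → Set
  F ≈seq G = seqTree F ≡ᵗ seqTree G

  _≐_ : STy → STy → Set
  T ≐ U = ∀ a → lab T a ≡ lab U a

  -- S-contexts and the (partial) disjoint union
  -- E = C ⊎ (⊎_{k∈K'} D_k), where K' is (the index set of) A.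

  SCtx : Set
  SCtx = Var → SSeq

  data UnionAt (e c : Maybe STy) (A : SSeq) (ds : ℕ → Maybe STy) : Set where
    fromC : e ≡ c → (∀ (k : Dom A) → ds (proj₁ k) ≡ nothing) →
            UnionAt e c A ds
    fromD : c ≡ nothing → (k : Dom A) → ds (proj₁ k) ≡ e → Is-just e →
            (∀ (k' : Dom A) → proj₁ k' ≢ proj₁ k → ds (proj₁ k') ≡ nothing) →
            UnionAt e c A ds

  IsUnion : SCtx → SCtx → SSeq → (ℕ → SCtx) → Set
  IsUnion E C A D = ∀ x j → UnionAt (E x j) (C x j) A (λ n → D n x j)

  data SDer : SCtx → Term → STy → Set where
    sax  : ∀ {C x T} (k : ℕ) →
           C x k ≡ just T →
           (∀ j → j ≢ k → C x j ≡ nothing) →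
           (∀ y → y ≢ x → ∀ j → C y j ≡ nothing) →
           SDer C (var x) T
    sabs : ∀ {C C' x t T} →
           SDer C' t T →
           (∀ j → C x j ≡ nothing) →
           (∀ y → y ≢ x → ∀ j → C y j ≡ C' y j) →
           SDer C (lam x t) (mkArr (C' x) T)
    sapp : ∀ {C E t u U F T} (A : SSeq) (D : ℕ → SCtx) →
           SDer C t U →
           U ≐ mkArr F T →
           F ≈seq A →
           ((k : Dom A) → SDer (D (proj₁ k)) u (elt A k)) →
           IsUnion E C A D →
           SDer E (app t u) T

  -- R-types are ≡-classes of S-types: represented by an S-type, with
  -- equality ≈.  Multiset types are countable families of R-types up
  -- to bijective reindexing (equality _≅M_).

  RMult : Set
  RMult = Fam STy

  _≅M_ : RMult → RMult → Set
  M ≅M N = Match _≈_ (elt M) (elt N)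

  RCtx : Set
  RCtx = Var → RMult

  -- index set and elements of the multiset  G + Σ_{i∈I} Ds i
  SumIdx : RMult → {I : Set} → (I → RMult) → Set
  SumIdx G {I} Ds = Dom G ⊎ Σ I (λ i → Dom (Ds i))

  sumElt : (G : RMult) {I : Set} (Ds : I → RMult) → SumIdx G Ds → STy
  sumElt G Ds (inj₁ s)       = elt G s
  sumElt G Ds (inj₂ (i , s)) = elt (Ds i) s

  -- System R (all equalities between R-objects taken up to ≈ / ≅M)
  data RDer : RCtx → Term → STy → Set where
    rax  : ∀ {Γ x τ} →
           Match _≈_ (elt (Γ x)) (λ (_ : ⊤) → τ) →
           (∀ y → y ≢ x → Dom (Γ y) → ⊥) →
           RDer Γ (var x) τ
    rabs : ∀ {Γ Γ' x t τ U} →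
           RDer Γ' t τ →
           (Dom (Γ x) → ⊥) →
           (∀ y → y ≢ x → Γ y ≅M Γ' y) →
           U ≈ mkArr (Γ' x) τ →
           RDer Γ (lam x t) U
    rapp : ∀ {Γ E t u U τ} (M : RMult) (Δ : Dom M → RCtx) →
           RDer Γ t U →
           U ≈ mkArr M τ →
           ((i : Dom M) → RDer (Δ i) u (elt M i)) →
           (∀ x → Match _≈_ (sumElt (Γ x) (λ i → Δ i x)) (elt (E x))) →
           RDer E (app t u) τ

  -- Collapse: P collapses on Π when they have the same shape and each
  -- judgment C ⊢ u : T of P collapses to the corresponding judgment
  -- Γ ⊢ u : τ of Π (C̄ = Γ pointwise, T̄ = τ); the argument premises
  -- of P (indexed by tracks) correspond to those of Π via a bijection.

  CtxColl : SCtx → RCtx → Set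
  CtxColl C Γ = ∀ x → Match _≈_ (elt (C x)) (elt (Γ x))

  data Collapse : ∀ {C Γ t T τ} → SDer C t T → RDer Γ t τ → Set where
    cax  : ∀ {C Γ x T τ k p q r p' q'} →
           CtxColl C Γ → T ≈ τ →
           Collapse (sax {C} {x} {T} k p q r) (rax {Γ} {x} {τ} p' q')
    cabs : ∀ {C C' Γ Γ' x t T τ U}
             {P : SDer C' t T} {Π : RDer Γ' t τ} {p q p' q' r'} →
           CtxColl C Γ → mkArr (C' x) T ≈ U →
           Collapse P Π →
           Collapse (sabs {C} {C'} {x} P p q)
                    (rabs {Γ} {Γ'} {x} {t} {τ} {U} Π p' q' r')
    capp : ∀ {C E Γ G t u U F T V τ} {A : SSeq} {D : ℕ → SCtx}
             {M : RMult} {Δ : Dom M → RCtx}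
             {Pf : SDer C t U} {e : U ≐ mkArr F T} {eq : F ≈seq A}
             {Ps : (k : Dom A) → SDer (D (proj₁ k)) u (elt A k)}
             {un : IsUnion E C A D}
             {Πf : RDer Γ t V} {eV : V ≈ mkArr M τ}
             {Πs : (i : Dom M) → RDer (Δ i) u (elt M i)}
             {sm : ∀ x → Match _≈_ (sumElt (Γ x) (λ i → Δ i x)) (elt (G x))} →
           CtxColl E G → T ≈ τ →
           Collapse Pf Πf →
           (b : Bij (Dom A) (Dom M)) →
           ((k : Dom A) → Collapse (Ps k) (Πs (Bij.to b k))) →
           Collapse (sapp A D Pf e eq Ps un) (rapp M Δ Πf eV Πs sm)

-- Π is lifted to S_h by induction, carrying a position w of the derivation
-- tree: the axiom at w uses the single track coding w, the function premise
-- of an application at w is lifted at w·0 and its argument premise n at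
-- w·(n+1). All tracks used below w then code extensions of w, so the
-- contexts of the premises of every application are disjoint and their union
-- is defined. Types and contexts are only carried along up to ≡, which needs
-- ≡ to be an equivalence compatible with F → T, decomposable at an arrow, and
-- to identify sequence types whose elements match up to reindexing.

module Submission where

open import Defs
open import Data.Empty using (⊥; ⊥-elim)
open import Data.List using (List; []; _++_; _∷_; length)
open import Data.List.Properties using (++-assoc; ++-identityʳ; length-++; ∷-injective; ∷-injectiveʳ)
open import Data.Maybe using (Is-just; Maybe; just; nothing; to-witness)
open import Data.Maybe.Relation.Unary.Any using (just)
open import Data.Nat using (_+_; _≟_; _≤_; suc; s≤s; zero; z≤n; ℕ)
open import Data.Nat.Properties using (+-cancelˡ-≡; suc-injective)
open import Data.Product using (_,_; _×_; proj₁; proj₂; Σ)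
open import Data.Unit using (tt; ⊤)
open import Data.Unit.Properties using (⊤-irrelevant)
open import Relation.Binary.PropositionalEquality
open import Relation.Nullary using (Dec; no; yes; ¬_)
open import Data.Sum using (_⊎_; inj₁; inj₂)
open import Data.Nat.Binary using (1+[2_]; 2[1+_]; fromℕ; toℕ; ℕᵇ)
open import Data.Nat.Binary.Properties using (fromℕ-toℕ)
import Data.Maybe.Relation.Unary.Any as Any
import Data.Nat.Binary as ℕᵇ

Is-just-irrelevant : ∀ {A : Set} {m : Maybe A} (p q : Is-just m) → p ≡ q
Is-just-irrelevant = Any.irrelevant ⊤-irrelevant

just-to-witness : ∀ {A : Set} {m : Maybe A} (p : Is-just m) → m ≡ just (to-witness p)
just-to-witness (just tt) = refl

to-witness-cong : ∀ {A : Set} {m m' : Maybe A} → m ≡ m' →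
                  (p : Is-just m) (q : Is-just m') → to-witness p ≡ to-witness q
to-witness-cong refl p q = cong to-witness (Is-just-irrelevant p q)

¬Is-just-nothing : ∀ {A : Set} → ¬ Is-just {A = A} nothing
¬Is-just-nothing ()

¬Is-just⇒nothing : ∀ {A : Set} (m : Maybe A) → ¬ Is-just m → m ≡ nothing
¬Is-just⇒nothing (just x) ¬p = ⊥-elim (¬p (just tt))
¬Is-just⇒nothing nothing  ¬p = refl

Σ-Is-just-≡ : ∀ {X A : Set} {f : X → Maybe A} {s s' : Σ X (λ x → Is-just (f x))} →
              proj₁ s ≡ proj₁ s' → s ≡ s'
Σ-Is-just-≡ {s = a , p} {.a , q} refl = cong (a ,_) (Is-just-irrelevant p q)

onJust : {A B : Set} (m : Maybe A) → (Is-just m → B) → B → B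
onJust (just _) f b = f (just tt)
onJust nothing  f b = b

onJust-just : {A B : Set} {m : Maybe A} (f : Is-just m → B) (b : B) (p : Is-just m) →
              onJust m f b ≡ f p
onJust-just f b (just tt) = refl

onJust-Is-just : {A B : Set} (P : B → Set) (m : Maybe A) {f : Is-just m → B} {b : B} →
                 ¬ P b → P (onJust m f b) → Is-just m
onJust-Is-just P (just _) ¬Pb Pm = just tt
onJust-Is-just P nothing  ¬Pb Pb = ⊥-elim (¬Pb Pb)

⊑-refl : ∀ (a : Pos) → a ⊑ a
⊑-refl a = [] , ++-identityʳ a

⊑-length : ∀ {a b : Pos} → a ⊑ b → length a ≤ length b
⊑-length {[]}    _          = z≤n
⊑-length {x ∷ a} (c , refl) = s≤s (⊑-length {a} (c , refl))

⊑-unique : ∀ {a a' b : Pos} → a ⊑ b → a' ⊑ b → length a ≡ length a' → a ≡ a'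
⊑-unique {[]}    {[]}     _          _        _ = refl
⊑-unique {x ∷ a} {y ∷ a'} (c , refl) (c' , e) l with ∷-injective e
... | refl , e' = cong (x ∷_) (⊑-unique (c , refl) (c' , e') (suc-injective l))

prefixOfLength : ∀ n (a : Pos) → n ≤ length a → Σ Pos (λ b → b ⊑ a × length b ≡ n)
prefixOfLength zero    a       _         = [] , (a , refl) , refl
prefixOfLength (suc n) (x ∷ a) (s≤s n≤a) with prefixOfLength n a n≤a
... | b , (c , e) , l = x ∷ b , (c , cong (x ∷_) e) , cong suc l

length≡0 : ∀ (a : Pos) → length a ≡ 0 → a ≡ []
length≡0 [] refl = refl

length≡1 : ∀ (a : Pos) → length a ≡ 1 → Σ ℕ (λ k → a ≡ k ∷ [])
length≡1 (k ∷ []) refl = k , refl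

dropHead : Pos → Pos
dropHead []      = []
dropHead (_ ∷ a) = a

-- Equivalence of labelled trees

_≅_ : {O : Set} → Tree O → Tree O → Set
_≅_ {O} = _≡ᵗ_ O

module _ {O : Set} where

  Supp : Tree O → Set
  Supp = TSupp O

  -- The shape invariants of S-types that also hold for the trees of
  -- sequence types, which have no root.
  record WellShaped (t : Tree O) : Set where
    field
      prefix-closed : ∀ x a c → Is-just (t (x ∷ a ++ c)) → Is-just (t (x ∷ a))
      no-track0     : ∀ a → ¬ Is-just (t (a ++ 0 ∷ []))
      has-codomain  : ∀ a k → Is-just (t a) → Is-just (t (a ++ k ∷ [])) →
                      Is-just (t (a ++ 1 ∷ []))

  STy-prefix-closed : (S : STy O) → ∀ a c → Is-just (lab S (a ++ c)) → Is-just (lab S a)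
  STy-prefix-closed S a []      p = subst Is-just (cong (lab S) (++-identityʳ a)) p
  STy-prefix-closed S a (k ∷ c) p =
    let q = STy-prefix-closed S (a ++ k ∷ []) c (subst Is-just (cong (lab S) (sym (++-assoc a (k ∷ []) c))) p)
    in subst Is-just (sym (IsSTy.parent (wf S) a k q)) (just tt)

  STy-wellShaped : (S : STy O) → WellShaped (lab S)
  STy-wellShaped S = record
    { prefix-closed = λ x a c → STy-prefix-closed S (x ∷ a) c
    ; no-track0     = IsSTy.no0 (wf S)
    ; has-codomain  = λ a k _ q → IsSTy.cod (wf S) a (IsSTy.parent (wf S) a k q) }

  seqTree-wellShaped : (F : SSeq O) → WellShaped (seqTree O F)
  seqTree-wellShaped F = record { prefix-closed = pc ; no-track0 = n0 ; has-codomain = hc }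
    where
      pc : ∀ x a c → Is-just (seqTree O F (x ∷ a ++ c)) → Is-just (seqTree O F (x ∷ a))
      pc (suc (suc n)) a c p with F n
      ... | just S = STy-prefix-closed S a c p
      pc (suc (suc n)) a c () | nothing
      n0 : ∀ a → ¬ Is-just (seqTree O F (a ++ 0 ∷ []))
      n0 (suc (suc n) ∷ a) p with F n
      ... | just S = IsSTy.no0 (wf S) a p
      n0 (suc (suc n) ∷ a) () | nothing
      hc : ∀ a k → Is-just (seqTree O F a) → Is-just (seqTree O F (a ++ k ∷ [])) →
           Is-just (seqTree O F (a ++ 1 ∷ []))
      hc (suc (suc n) ∷ a) k p q with F n
      ... | just S = WellShaped.has-codomain (STy-wellShaped S) a k p q
      hc (suc (suc n) ∷ a) k () q | nothing

  -- t ≅ u presented by total maps on positions, constrained only on the supports.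
  record PosIso (t u : Tree O) : Set where
    field
      fwd bwd  : Pos → Pos
      fwd-supp : ∀ a → Is-just (t a) → Is-just (u (fwd a))
      bwd-supp : ∀ b → Is-just (u b) → Is-just (t (bwd b))
      bwd∘fwd  : ∀ a → Is-just (t a) → bwd (fwd a) ≡ a
      fwd∘bwd  : ∀ b → Is-just (u b) → fwd (bwd b) ≡ b
      label    : ∀ a → Is-just (t a) → u (fwd a) ≡ t a
      mono     : ∀ a a' → Is-just (t a) → Is-just (t a') → a ⊑ a' → fwd a ⊑ fwd a'
      length≡  : ∀ a → Is-just (t a) → length (fwd a) ≡ length a
      step     : ∀ a a' k → Is-just (t a) → Is-just (t a') → k ≤ 1 →
                 a' ≡ a ++ k ∷ [] → fwd a' ≡ fwd a ++ k ∷ []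

  PosIso⇒≅ : ∀ {t u} → PosIso t u → t ≅ u
  PosIso⇒≅ P = record
    { φ       = record { to      = λ (a , p) → fwd a , fwd-supp a p
                       ; from    = λ (b , q) → bwd b , bwd-supp b q
                       ; from∘to = λ (a , p) → Σ-Is-just-≡ (bwd∘fwd a p)
                       ; to∘from = λ (b , q) → Σ-Is-just-≡ (fwd∘bwd b q) }
    ; label   = λ (a , p) → label a p
    ; mono    = λ (a , p) (a' , p') → mono a a' p p'
    ; lengthφ = λ (a , p) → length≡ a p
    ; step    = λ (a , p) (a' , p') k → step a a' k p p' }
    where open PosIso P

  ≅-reflexive : ∀ {t u : Tree O} → (∀ a → t a ≡ u a) → t ≅ u
  ≅-reflexive e = PosIso⇒≅ record
    { fwd = λ a → a ; bwd = λ b → b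
    ; fwd-supp = λ a → subst Is-just (e a) ; bwd-supp = λ b → subst Is-just (sym (e b))
    ; bwd∘fwd = λ _ _ → refl ; fwd∘bwd = λ _ _ → refl
    ; label = λ a _ → sym (e a)
    ; mono = λ _ _ _ _ le → le ; length≡ = λ _ _ → refl ; step = λ _ _ _ _ _ _ e' → e' }

  ≅-trans : ∀ {t u v : Tree O} → t ≅ u → u ≅ v → t ≅ v
  ≅-trans i j = record
    { φ       = record { to      = λ s → J.to (I.to s)
                       ; from    = λ s → I.from (J.from s)
                       ; from∘to = λ s → trans (cong I.from (J.from∘to (I.to s))) (I.from∘to s)
                       ; to∘from = λ s → trans (cong J.to (I.to∘from (J.from s))) (J.to∘from s) }
    ; label   = λ s → trans (_≡ᵗ_.label j (I.to s)) (_≡ᵗ_.label i s)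
    ; mono    = λ s s' le → _≡ᵗ_.mono j _ _ (_≡ᵗ_.mono i s s' le)
    ; lengthφ = λ s → trans (_≡ᵗ_.lengthφ j (I.to s)) (_≡ᵗ_.lengthφ i s)
    ; step    = λ s s' k k≤1 e → _≡ᵗ_.step j _ _ k k≤1 (_≡ᵗ_.step i s s' k k≤1 e) }
    where module I = Bij (_≡ᵗ_.φ i)
          module J = Bij (_≡ᵗ_.φ j)

  -- The definition of ≅ only asks φ to be monotone and to respect
  -- children; for φ⁻¹ this needs the shape invariants of both trees.
  module Inverse {t u : Tree O} (wt : WellShaped t) (wu : WellShaped u) (i : t ≅ u) where
    open _≡ᵗ_ i
    open Bij φ

    from-length : ∀ s → length (pos O (from s)) ≡ length (pos O s)
    from-length s = sym (trans (cong (λ z → length (pos O z)) (sym (to∘from s))) (lengthφ (from s)))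

    from-mono : ∀ (s s' : Supp u) → pos O s ⊑ pos O s' → pos O (from s) ⊑ pos O (from s')
    from-mono s s' le with pos O (from s) in ea
    ... | []     = pos O (from s') , refl
    ... | x ∷ a₀ = subst (_⊑ pos O (from s')) (trans (cong proj₁ b≡from-s) ea) (c , e)
      where
        len≤ : length (x ∷ a₀) ≤ length (pos O (from s'))
        len≤ = subst₂ _≤_ (trans (sym (from-length s)) (cong length ea)) (sym (from-length s')) (⊑-length le)
        cut = prefixOfLength (length (x ∷ a₀)) (pos O (from s')) len≤
        b = proj₁ cut
        c = proj₁ (proj₁ (proj₂ cut))
        e : b ++ c ≡ pos O (from s')
        e = proj₂ (proj₁ (proj₂ cut))
        b-in : Is-just (t b)
        b-in with b | e | proj₂ (proj₂ cut)
        ... | y ∷ b' | e' | _ = WellShaped.prefix-closed wt y b' c (subst Is-just (cong t (sym e')) (proj₂ (from s')))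
        to-b≡s : pos O (to (b , b-in)) ≡ pos O s
        to-b≡s = ⊑-unique (subst (λ z → pos O (to (b , b-in)) ⊑ pos O z) (to∘from s') (mono (b , b-in) (from s') (c , e))) le
                   (trans (lengthφ (b , b-in)) (trans (proj₂ (proj₂ cut)) (trans (cong length (sym ea)) (from-length s))))
        b≡from-s : (b , b-in) ≡ from s
        b≡from-s = trans (sym (from∘to (b , b-in))) (cong from (Σ-Is-just-≡ to-b≡s))

    from-step : ∀ (s s' : Supp u) k → k ≤ 1 → pos O s' ≡ pos O s ++ k ∷ [] →
                pos O (from s') ≡ pos O (from s) ++ k ∷ []
    from-step s s' .0 z≤n e = ⊥-elim (WellShaped.no-track0 wu (pos O s) (subst Is-just (cong u e) (proj₂ s')))
    from-step s s' .1 (s≤s z≤n) e = sym (cong proj₁ a1≡from-s')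
      where
        a = pos O (from s)
        ext = from-mono s s' ((1 ∷ []) , sym e)
        c = proj₁ ext
        ec : a ++ c ≡ pos O (from s')
        ec = proj₂ ext
        c-length : length c ≡ 1
        c-length = +-cancelˡ-≡ (length a) _ _ (trans (sym (length-++ a)) (trans (cong length ec)
                     (trans (from-length s') (trans (cong length e) (trans (length-++ (pos O s))
                       (cong (_+ 1) (sym (from-length s))))))))
        k' = proj₁ (length≡1 c c-length)
        a1-in : Is-just (t (a ++ 1 ∷ []))
        a1-in = WellShaped.has-codomain wt a k' (proj₂ (from s))
                  (subst Is-just (cong t (trans (sym ec) (cong (a ++_) (proj₂ (length≡1 c c-length))))) (proj₂ (from s')))
        a1 : Supp t
        a1 = (a ++ 1 ∷ []) , a1-in
        a1≡from-s' : a1 ≡ from s'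
        a1≡from-s' = trans (sym (from∘to a1)) (cong from (Σ-Is-just-≡
                       (trans (step (from s) a1 1 (s≤s z≤n) refl)
                         (trans (cong (λ z → pos O z ++ 1 ∷ []) (to∘from s)) (sym e)))))

    ≅-sym : u ≅ t
    ≅-sym = record
      { φ       = record { to = from ; from = to ; from∘to = to∘from ; to∘from = from∘to }
      ; label   = λ s → sym (trans (cong (λ z → u (pos O z)) (sym (to∘from s))) (label (from s)))
      ; mono    = from-mono
      ; lengthφ = from-length
      ; step    = from-step }

  open Inverse using (≅-sym) public

  -- φ extended by the identity outside the support of t.
  apply : ∀ {t u : Tree O} → t ≅ u → Pos → Pos
  apply {t} i a = onJust (t a) (λ p → pos O (Bij.to (_≡ᵗ_.φ i) (a , p))) a

  apply-supp : ∀ {t u : Tree O} (i : t ≅ u) a (p : Is-just (t a)) →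
               apply i a ≡ pos O (Bij.to (_≡ᵗ_.φ i) (a , p))
  apply-supp i a p = onJust-just _ a p

  ≅⇒PosIso : ∀ {t u : Tree O} → WellShaped t → WellShaped u → t ≅ u → PosIso t u
  ≅⇒PosIso {t} {u} wt wu i = record
    { fwd = apply i ; bwd = apply j
    ; fwd-supp = fwd-supp ; bwd-supp = bwd-supp
    ; bwd∘fwd = λ a p → trans (apply-supp j (apply i a) (fwd-supp a p))
                          (trans (cong (λ z → pos O (from z)) (Σ-Is-just-≡ (apply-supp i a p)))
                                 (cong proj₁ (from∘to (a , p))))
    ; fwd∘bwd = λ b q → trans (apply-supp i (apply j b) (bwd-supp b q))
                          (trans (cong (λ z → pos O (to z)) (Σ-Is-just-≡ (apply-supp j b q)))
                                 (cong proj₁ (to∘from (b , q))))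
    ; label = λ a p → trans (cong u (apply-supp i a p)) (label (a , p))
    ; mono = λ a a' p p' le → subst₂ _⊑_ (sym (apply-supp i a p)) (sym (apply-supp i a' p'))
                                (mono (a , p) (a' , p') le)
    ; length≡ = λ a p → trans (cong length (apply-supp i a p)) (lengthφ (a , p))
    ; step = λ a a' k p p' k≤1 e → trans (apply-supp i a' p')
               (trans (step (a , p) (a' , p') k k≤1 e) (cong (_++ k ∷ []) (sym (apply-supp i a p)))) }
    where
      j = ≅-sym wt wu i
      open _≡ᵗ_ i
      open Bij φ
      fwd-supp : ∀ a → Is-just (t a) → Is-just (u (apply i a))
      fwd-supp a p = subst Is-just (cong u (sym (apply-supp i a p))) (proj₂ (to (a , p)))
      bwd-supp : ∀ b → Is-just (u b) → Is-just (t (apply j b))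
      bwd-supp b q = subst Is-just (cong t (sym (apply-supp j b q))) (proj₂ (from (b , q)))

-- Arrow types

∷-⊑ : ∀ {x : ℕ} {a b : Pos} → (x ∷ a) ⊑ (x ∷ b) → a ⊑ b
∷-⊑ (c , e) = c , ∷-injectiveʳ e

≡∷⇒≡∷dropHead : ∀ {x : Pos} {k : ℕ} {c : Pos} → x ≡ k ∷ c → x ≡ k ∷ dropHead x
≡∷⇒≡∷dropHead refl = refl

module _ {O : Set} where

  arrTree≡seqTree : ∀ {F T} a → Is-just (seqTree O F a) → arrTree O F T a ≡ seqTree O F a
  arrTree≡seqTree (suc (suc n) ∷ a) p = refl

  seqTree⊆arrTree : ∀ {F T} a → Is-just (seqTree O F a) → Is-just (arrTree O F T a)
  seqTree⊆arrTree {T = T} a p = subst Is-just (sym (arrTree≡seqTree {T = T} a p)) p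

  arrTree-PosIso : ∀ {F G : SSeq O} {T T' : STy O} →
          arrTree O F T ≅ arrTree O G T' → PosIso (arrTree O F T) (arrTree O G T')
  arrTree-PosIso {F} {G} {T} {T'} = ≅⇒PosIso (STy-wellShaped (mkArr O F T)) (STy-wellShaped (mkArr O G T'))

  module ArrowPosIso {F G : SSeq O} {T T' : STy O} (P : PosIso (arrTree O F T) (arrTree O G T')) where
    open PosIso P

    fwd-root : fwd [] ≡ []
    fwd-root = length≡0 _ (length≡ [] (just tt))

    fwd-cod : fwd (1 ∷ []) ≡ 1 ∷ []
    fwd-cod = trans (step [] (1 ∷ []) 1 (just tt) (IsSTy.root (wf T)) (s≤s z≤n) refl) (cong (_++ 1 ∷ []) fwd-root)

    fwd-cod-branch : ∀ a → Is-just (lab T a) → fwd (1 ∷ a) ≡ 1 ∷ dropHead (fwd (1 ∷ a))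
    fwd-cod-branch a p with mono (1 ∷ []) (1 ∷ a) (IsSTy.root (wf T)) p (a , refl)
    ... | c , e = ≡∷⇒≡∷dropHead (trans (sym e) (cong (_++ c) fwd-cod))

    -- An argument track cannot be sent to track 1, which is the image of track 1.
    fwd-seq-branch : ∀ a → Is-just (seqTree O F a) → Is-just (seqTree O G (fwd a))
    fwd-seq-branch (suc (suc n) ∷ a) p = image-track (length≡1 (fwd h) (length≡ h h-in)) (mono h _ h-in p (a , refl))
      where
        h = suc (suc n) ∷ []
        h-in = WellShaped.prefix-closed (STy-wellShaped (mkArr O F T)) (suc (suc n)) [] a p
        image-track : Σ ℕ (λ k → fwd h ≡ k ∷ []) → fwd h ⊑ fwd (suc (suc n) ∷ a) →
                      Is-just (seqTree O G (fwd (suc (suc n) ∷ a)))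
        image-track (zero , e) _ = ⊥-elim (¬Is-just-nothing (subst Is-just (cong (arrTree O G T') e) (fwd-supp h h-in)))
        image-track (suc zero , e) _ with trans (sym (bwd∘fwd h h-in))
                                            (trans (cong bwd (trans e (sym fwd-cod))) (bwd∘fwd (1 ∷ []) (IsSTy.root (wf T))))
        ... | ()
        image-track (suc (suc m) , e) (c , e') =
          subst (λ b → Is-just (seqTree O G b)) (sym img) (subst (λ b → Is-just (arrTree O G T' b)) img (fwd-supp _ p))
          where img : fwd (suc (suc n) ∷ a) ≡ suc (suc m) ∷ c
                img = trans (sym e') (cong (_++ c) e)

  PosIso-restrict : ∀ {t u t' u' : Tree O} (P : PosIso t u) →
                    (∀ a → Is-just (t' a) → t a ≡ t' a) → (∀ b → Is-just (u' b) → u b ≡ u' b) →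
                    (∀ a → Is-just (t' a) → Is-just (u' (PosIso.fwd P a))) →
                    (∀ b → Is-just (u' b) → Is-just (t' (PosIso.bwd P b))) →
                    PosIso t' u'
  PosIso-restrict {t} {u} {t'} {u'} P t≡ u≡ fwd-supp' bwd-supp' = record
    { fwd = fwd ; bwd = bwd ; fwd-supp = fwd-supp' ; bwd-supp = bwd-supp'
    ; bwd∘fwd = λ a p → bwd∘fwd a (in-t a p)
    ; fwd∘bwd = λ b q → fwd∘bwd b (in-u b q)
    ; label = λ a p → trans (sym (u≡ (fwd a) (fwd-supp' a p))) (trans (label a (in-t a p)) (t≡ a p))
    ; mono = λ a a' p p' → mono a a' (in-t a p) (in-t a' p')
    ; length≡ = λ a p → length≡ a (in-t a p)
    ; step = λ a a' k p p' → step a a' k (in-t a p) (in-t a' p') }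
    where
      open PosIso P
      in-t : ∀ a → Is-just (t' a) → Is-just (t a)
      in-t a p = subst Is-just (sym (t≡ a p)) p
      in-u : ∀ b → Is-just (u' b) → Is-just (u b)
      in-u b q = subst Is-just (sym (u≡ b q)) q

  module _ {F G : SSeq O} {T T' : STy O} (i : arrTree O F T ≅ arrTree O G T') where
    private
      P = arrTree-PosIso i
      Q = arrTree-PosIso (≅-sym (STy-wellShaped (mkArr O F T)) (STy-wellShaped (mkArr O G T')) i)
      module P = PosIso P
      module PA = ArrowPosIso P
      module QA = ArrowPosIso Q

      ∷-mono : ∀ {x : ℕ} {a b : Pos} → a ⊑ b → (x ∷ a) ⊑ (x ∷ b)
      ∷-mono {x} (c , e) = c , cong (x ∷_) e

    arr-≅⇒cod-≅ : lab T ≅ lab T'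
    arr-≅⇒cod-≅ = PosIso⇒≅ record
      { fwd = λ a → dropHead (P.fwd (1 ∷ a)) ; bwd = λ b → dropHead (P.bwd (1 ∷ b))
      ; fwd-supp = λ a p → subst (λ x → Is-just (arrTree O G T' x)) (PA.fwd-cod-branch a p) (P.fwd-supp (1 ∷ a) p)
      ; bwd-supp = λ b q → subst (λ x → Is-just (arrTree O F T x)) (QA.fwd-cod-branch b q) (P.bwd-supp (1 ∷ b) q)
      ; bwd∘fwd = λ a p → cong dropHead (trans (cong P.bwd (sym (PA.fwd-cod-branch a p))) (P.bwd∘fwd (1 ∷ a) p))
      ; fwd∘bwd = λ b q → cong dropHead (trans (cong P.fwd (sym (QA.fwd-cod-branch b q))) (P.fwd∘bwd (1 ∷ b) q))
      ; label = λ a p → trans (cong (arrTree O G T') (sym (PA.fwd-cod-branch a p))) (P.label (1 ∷ a) p)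
      ; mono = λ a a' p p' le → ∷-⊑ (subst₂ _⊑_ (PA.fwd-cod-branch a p) (PA.fwd-cod-branch a' p')
                                        (P.mono (1 ∷ a) (1 ∷ a') p p' (∷-mono le)))
      ; length≡ = λ a p → suc-injective (trans (cong length (sym (PA.fwd-cod-branch a p))) (P.length≡ (1 ∷ a) p))
      ; step = λ a a' k p p' k≤1 e → cong dropHead (trans (P.step (1 ∷ a) (1 ∷ a') k p p' k≤1 (cong (1 ∷_) e))
                                                      (cong (_++ k ∷ []) (PA.fwd-cod-branch a p))) }

    arr-≅⇒seq-≅ : seqTree O F ≅ seqTree O G
    arr-≅⇒seq-≅ = PosIso⇒≅ (PosIso-restrict P arrTree≡seqTree arrTree≡seqTree PA.fwd-seq-branch QA.fwd-seq-branch)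

  module _ {F G : SSeq O} {T T' : STy O} (iT : lab T ≅ lab T') (iF : seqTree O F ≅ seqTree O G) where
    private
      module PT = PosIso (≅⇒PosIso (STy-wellShaped T) (STy-wellShaped T') iT)
      module PS = PosIso (≅⇒PosIso (seqTree-wellShaped F) (seqTree-wellShaped G) iF)

      fwd : Pos → Pos
      fwd []                = []
      fwd (zero ∷ a)        = []
      fwd (suc zero ∷ a)    = 1 ∷ PT.fwd a
      fwd (suc (suc n) ∷ a) = PS.fwd (suc (suc n) ∷ a)

      bwd : Pos → Pos
      bwd []                = []
      bwd (zero ∷ b)        = []
      bwd (suc zero ∷ b)    = 1 ∷ PT.bwd b
      bwd (suc (suc n) ∷ b) = PS.bwd (suc (suc n) ∷ b)

      fwd-seq : ∀ a → Is-just (seqTree O F a) → fwd a ≡ PS.fwd a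
      fwd-seq (suc (suc n) ∷ a) p = refl

      bwd-seq : ∀ b → Is-just (seqTree O G b) → bwd b ≡ PS.bwd b
      bwd-seq (suc (suc n) ∷ b) q = refl

      fwd-supp : ∀ a → Is-just (arrTree O F T a) → Is-just (arrTree O G T' (fwd a))
      fwd-supp []                p = just tt
      fwd-supp (suc zero ∷ a)    p = PT.fwd-supp a p
      fwd-supp (suc (suc n) ∷ a) p = seqTree⊆arrTree {T = T'} (PS.fwd (suc (suc n) ∷ a)) (PS.fwd-supp _ p)

      bwd-supp : ∀ b → Is-just (arrTree O G T' b) → Is-just (arrTree O F T (bwd b))
      bwd-supp []                q = just tt
      bwd-supp (suc zero ∷ b)    q = PT.bwd-supp b q
      bwd-supp (suc (suc n) ∷ b) q = seqTree⊆arrTree {T = T} (PS.bwd (suc (suc n) ∷ b)) (PS.bwd-supp _ q)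

      bwd∘fwd : ∀ a → Is-just (arrTree O F T a) → bwd (fwd a) ≡ a
      bwd∘fwd []                p = refl
      bwd∘fwd (suc zero ∷ a)    p = cong (1 ∷_) (PT.bwd∘fwd a p)
      bwd∘fwd (suc (suc n) ∷ a) p = trans (bwd-seq (PS.fwd (suc (suc n) ∷ a)) (PS.fwd-supp _ p)) (PS.bwd∘fwd _ p)

      fwd∘bwd : ∀ b → Is-just (arrTree O G T' b) → fwd (bwd b) ≡ b
      fwd∘bwd []                q = refl
      fwd∘bwd (suc zero ∷ b)    q = cong (1 ∷_) (PT.fwd∘bwd b q)
      fwd∘bwd (suc (suc n) ∷ b) q = trans (fwd-seq (PS.bwd (suc (suc n) ∷ b)) (PS.bwd-supp _ q)) (PS.fwd∘bwd _ q)

      label : ∀ a → Is-just (arrTree O F T a) → arrTree O G T' (fwd a) ≡ arrTree O F T a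
      label []                p = refl
      label (suc zero ∷ a)    p = PT.label a p
      label (suc (suc n) ∷ a) p = trans (arrTree≡seqTree {T = T'} (PS.fwd (suc (suc n) ∷ a)) (PS.fwd-supp _ p)) (PS.label (suc (suc n) ∷ a) p)

      mono : ∀ a a' → Is-just (arrTree O F T a) → Is-just (arrTree O F T a') → a ⊑ a' → fwd a ⊑ fwd a'
      mono []                a'                        p p' le         = fwd a' , refl
      mono (suc zero ∷ a)    .(suc zero ∷ a ++ c)      p p' (c , refl) =
        let (d , e) = PT.mono a (a ++ c) p p' (c , refl) in d , cong (1 ∷_) e
      mono (suc (suc n) ∷ a) .(suc (suc n) ∷ a ++ c)  p p' (c , refl) = PS.mono _ _ p p' (c , refl)

      length≡ : ∀ a → Is-just (arrTree O F T a) → length (fwd a) ≡ length a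
      length≡ []                p = refl
      length≡ (suc zero ∷ a)    p = cong suc (PT.length≡ a p)
      length≡ (suc (suc n) ∷ a) p = PS.length≡ _ p

      step : ∀ a a' k → Is-just (arrTree O F T a) → Is-just (arrTree O F T a') → k ≤ 1 →
             a' ≡ a ++ k ∷ [] → fwd a' ≡ fwd a ++ k ∷ []
      step []                .(0 ∷ [])                  zero           p () k≤1 refl
      step []                .(1 ∷ [])                  (suc zero)     p p' k≤1 refl =
        cong (λ b → 1 ∷ b) (length≡0 _ (PT.length≡ [] (IsSTy.root (wf T))))
      step []                _                          (suc (suc k)) p p' (s≤s ()) refl
      step (suc zero ∷ a)    .(suc zero ∷ a ++ k ∷ [])    k p p' k≤1 refl = cong (1 ∷_) (PT.step a _ k p p' k≤1 refl)
      step (suc (suc n) ∷ a) .(suc (suc n) ∷ a ++ k ∷ []) k p p' k≤1 refl = PS.step _ _ k p p' k≤1 refl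

    arr-≅-cong : arrTree O F T ≅ arrTree O G T'
    arr-≅-cong = PosIso⇒≅ record
      { fwd = fwd ; bwd = bwd ; fwd-supp = fwd-supp ; bwd-supp = bwd-supp ; bwd∘fwd = bwd∘fwd
      ; fwd∘bwd = fwd∘bwd ; label = label ; mono = mono ; length≡ = length≡ ; step = step }

-- Sequence types

module _ {O : Set} where

  trackTree : Maybe (STy O) → Tree O
  trackTree (just S) = lab S
  trackTree nothing  = λ _ → nothing

  seqTree-track : ∀ (F : SSeq O) n a → seqTree O F (suc (suc n) ∷ a) ≡ trackTree (F n) a
  seqTree-track F n a with F n
  ... | just S  = refl
  ... | nothing = refl

  seqTree-elt : ∀ {F : SSeq O} n a (p : Is-just (F n)) → seqTree O F (suc (suc n) ∷ a) ≡ lab (to-witness p) a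
  seqTree-elt {F} n a p = trans (seqTree-track F n a) (cong (λ m → trackTree m a) (just-to-witness p))

  seqTree-dom : ∀ {F : SSeq O} n a → Is-just (seqTree O F (suc (suc n) ∷ a)) → Is-just (F n)
  seqTree-dom {F} n a w with F n
  ... | just S = just tt

  module Pointwise {F H : SSeq O}
                   (F⇒H : ∀ n → Is-just (F n) → Is-just (H n)) (H⇒F : ∀ n → Is-just (H n) → Is-just (F n))
                   (Ψ : ∀ n (p : Is-just (F n)) (q : Is-just (H n)) → lab (to-witness p) ≅ lab (to-witness q)) where
    private
      Ψ⁻¹ : ∀ n (p : Is-just (F n)) (q : Is-just (H n)) → lab (to-witness q) ≅ lab (to-witness p)
      Ψ⁻¹ n p q = ≅-sym (STy-wellShaped (to-witness p)) (STy-wellShaped (to-witness q)) (Ψ n p q)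

      module Branch n (p : Is-just (F n)) (q : Is-just (H n)) =
        PosIso (≅⇒PosIso (STy-wellShaped (to-witness p)) (STy-wellShaped (to-witness q)) (Ψ n p q))

      fwd : Pos → Pos
      fwd (suc (suc n) ∷ a) = onJust (F n) (λ p → onJust (H n) (λ q → suc (suc n) ∷ apply (Ψ n p q) a) []) []
      fwd _                 = []

      bwd : Pos → Pos
      bwd (suc (suc n) ∷ b) = onJust (H n) (λ q → onJust (F n) (λ p → suc (suc n) ∷ apply (Ψ⁻¹ n p q) b) []) []
      bwd _                 = []

      fwd-track : ∀ n a p q → fwd (suc (suc n) ∷ a) ≡ suc (suc n) ∷ Branch.fwd n p q a
      fwd-track n a p q = trans (onJust-just _ [] p) (onJust-just _ [] q)

      bwd-track : ∀ n b p q → bwd (suc (suc n) ∷ b) ≡ suc (suc n) ∷ Branch.bwd n p q b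
      bwd-track n b p q = trans (onJust-just _ [] q) (onJust-just _ [] p)

      elt-F = seqTree-elt {F}
      elt-H = seqTree-elt {H}

      fwd-supp : ∀ a → Is-just (seqTree O F a) → Is-just (seqTree O H (fwd a))
      fwd-supp (suc (suc n) ∷ a) w = subst (λ b → Is-just (seqTree O H b)) (sym (fwd-track n a p q))
                                       (subst Is-just (sym (elt-H n _ q)) (Branch.fwd-supp n p q a (subst Is-just (elt-F n a p) w)))
        where p = seqTree-dom {F} n a w
              q = F⇒H n p

      bwd-supp : ∀ b → Is-just (seqTree O H b) → Is-just (seqTree O F (bwd b))
      bwd-supp (suc (suc n) ∷ b) w = subst (λ a → Is-just (seqTree O F a)) (sym (bwd-track n b p q))
                                       (subst Is-just (sym (elt-F n _ p)) (Branch.bwd-supp n p q b (subst Is-just (elt-H n b q) w)))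
        where q = seqTree-dom {H} n b w
              p = H⇒F n q

      bwd∘fwd : ∀ a → Is-just (seqTree O F a) → bwd (fwd a) ≡ a
      bwd∘fwd (suc (suc n) ∷ a) w = trans (cong bwd (fwd-track n a p q))
                                      (trans (bwd-track n _ p q) (cong (suc (suc n) ∷_) (Branch.bwd∘fwd n p q a (subst Is-just (elt-F n a p) w))))
        where p = seqTree-dom {F} n a w
              q = F⇒H n p

      fwd∘bwd : ∀ b → Is-just (seqTree O H b) → fwd (bwd b) ≡ b
      fwd∘bwd (suc (suc n) ∷ b) w = trans (cong fwd (bwd-track n b p q))
                                      (trans (fwd-track n _ p q) (cong (suc (suc n) ∷_) (Branch.fwd∘bwd n p q b (subst Is-just (elt-H n b q) w))))
        where q = seqTree-dom {H} n b w
              p = H⇒F n q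

      label : ∀ a → Is-just (seqTree O F a) → seqTree O H (fwd a) ≡ seqTree O F a
      label (suc (suc n) ∷ a) w = trans (cong (seqTree O H) (fwd-track n a p q))
                                    (trans (elt-H n _ q) (trans (Branch.label n p q a (subst Is-just (elt-F n a p) w)) (sym (elt-F n a p))))
        where p = seqTree-dom {F} n a w
              q = F⇒H n p

      mono : ∀ a a' → Is-just (seqTree O F a) → Is-just (seqTree O F a') → a ⊑ a' → fwd a ⊑ fwd a'
      mono (suc (suc n) ∷ a) .(suc (suc n) ∷ a ++ c) w w' (c , refl) =
        subst₂ _⊑_ (sym (fwd-track n a p q)) (sym (fwd-track n (a ++ c) p q)) (d , cong (suc (suc n) ∷_) e)
        where p = seqTree-dom {F} n a w
              q = F⇒H n p
              de = Branch.mono n p q a (a ++ c) (subst Is-just (elt-F n a p) w) (subst Is-just (elt-F n (a ++ c) p) w') (c , refl)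
              d = proj₁ de
              e = proj₂ de

      length≡ : ∀ a → Is-just (seqTree O F a) → length (fwd a) ≡ length a
      length≡ (suc (suc n) ∷ a) w = trans (cong length (fwd-track n a p q)) (cong suc (Branch.length≡ n p q a (subst Is-just (elt-F n a p) w)))
        where p = seqTree-dom {F} n a w
              q = F⇒H n p

      step : ∀ a a' k → Is-just (seqTree O F a) → Is-just (seqTree O F a') → k ≤ 1 →
             a' ≡ a ++ k ∷ [] → fwd a' ≡ fwd a ++ k ∷ []
      step (suc (suc n) ∷ a) .(suc (suc n) ∷ a ++ k ∷ []) k w w' k≤1 refl =
        trans (fwd-track n (a ++ k ∷ []) p q)
          (trans (cong (suc (suc n) ∷_) (Branch.step n p q a _ k (subst Is-just (elt-F n a p) w) (subst Is-just (elt-F n _ p) w') k≤1 refl))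
                 (cong (_++ k ∷ []) (sym (fwd-track n a p q))))
        where p = seqTree-dom {F} n a w
              q = F⇒H n p

    seq-≅-pointwise : seqTree O F ≅ seqTree O H
    seq-≅-pointwise = PosIso⇒≅ record
      { fwd = fwd ; bwd = bwd ; fwd-supp = fwd-supp ; bwd-supp = bwd-supp ; bwd∘fwd = bwd∘fwd
      ; fwd∘bwd = fwd∘bwd ; label = label ; mono = mono ; length≡ = length≡ ; step = step }

  module Reindex {F G : SSeq O} (ρ : Bij (Dom F) (Dom G)) (elt≡ : ∀ k → elt G (Bij.to ρ k) ≡ elt F k) where
    private
      open Bij ρ

      fwd : Pos → Pos
      fwd (suc (suc n) ∷ a) = onJust (F n) (λ p → suc (suc (proj₁ (to (n , p)))) ∷ a) []
      fwd _                 = []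

      bwd : Pos → Pos
      bwd (suc (suc m) ∷ b) = onJust (G m) (λ q → suc (suc (proj₁ (from (m , q)))) ∷ b) []
      bwd _                 = []

      fwd-track : ∀ n a p → fwd (suc (suc n) ∷ a) ≡ suc (suc (proj₁ (to (n , p)))) ∷ a
      fwd-track n a p = onJust-just _ [] p

      bwd-track : ∀ m b q → bwd (suc (suc m) ∷ b) ≡ suc (suc (proj₁ (from (m , q)))) ∷ b
      bwd-track m b q = onJust-just _ [] q

      label-track : ∀ n a (p : Is-just (F n)) →
                    seqTree O G (suc (suc (proj₁ (to (n , p)))) ∷ a) ≡ seqTree O F (suc (suc n) ∷ a)
      label-track n a p = trans (seqTree-elt {G} _ a (proj₂ (to (n , p))))
                            (trans (cong (λ S → lab S a) (elt≡ (n , p))) (sym (seqTree-elt {F} n a p)))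

      fwd-supp : ∀ a → Is-just (seqTree O F a) → Is-just (seqTree O G (fwd a))
      fwd-supp (suc (suc n) ∷ a) w = subst (λ b → Is-just (seqTree O G b)) (sym (fwd-track n a p))
                                       (subst Is-just (sym (label-track n a p)) w)
        where p = seqTree-dom {F} n a w

      bwd-supp : ∀ b → Is-just (seqTree O G b) → Is-just (seqTree O F (bwd b))
      bwd-supp (suc (suc m) ∷ b) w = subst (λ a → Is-just (seqTree O F a)) (sym (bwd-track m b q))
          (subst Is-just (trans (cong (λ k → seqTree O G (suc (suc (proj₁ k)) ∷ b)) (sym (to∘from (m , q))))
                                (label-track (proj₁ (from (m , q))) b (proj₂ (from (m , q))))) w)
        where q = seqTree-dom {G} m b w

      bwd∘fwd : ∀ a → Is-just (seqTree O F a) → bwd (fwd a) ≡ a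
      bwd∘fwd (suc (suc n) ∷ a) w = trans (cong bwd (fwd-track n a p))
          (trans (bwd-track _ a (proj₂ (to (n , p)))) (cong (λ k → suc (suc (proj₁ k)) ∷ a) (from∘to (n , p))))
        where p = seqTree-dom {F} n a w

      fwd∘bwd : ∀ b → Is-just (seqTree O G b) → fwd (bwd b) ≡ b
      fwd∘bwd (suc (suc m) ∷ b) w = trans (cong fwd (bwd-track m b q))
          (trans (fwd-track _ b (proj₂ (from (m , q)))) (cong (λ k → suc (suc (proj₁ k)) ∷ b) (to∘from (m , q))))
        where q = seqTree-dom {G} m b w

      label : ∀ a → Is-just (seqTree O F a) → seqTree O G (fwd a) ≡ seqTree O F a
      label (suc (suc n) ∷ a) w = trans (cong (seqTree O G) (fwd-track n a p)) (label-track n a p)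
        where p = seqTree-dom {F} n a w

      mono : ∀ a a' → Is-just (seqTree O F a) → Is-just (seqTree O F a') → a ⊑ a' → fwd a ⊑ fwd a'
      mono (suc (suc n) ∷ a) .(suc (suc n) ∷ a ++ c) w w' (c , refl) =
        subst₂ _⊑_ (sym (fwd-track n a p)) (sym (fwd-track n (a ++ c) p)) (c , refl)
        where p = seqTree-dom {F} n a w

      length≡ : ∀ a → Is-just (seqTree O F a) → length (fwd a) ≡ length a
      length≡ (suc (suc n) ∷ a) w = cong length (fwd-track n a (seqTree-dom {F} n a w))

      step : ∀ a a' k → Is-just (seqTree O F a) → Is-just (seqTree O F a') → k ≤ 1 →
             a' ≡ a ++ k ∷ [] → fwd a' ≡ fwd a ++ k ∷ []
      step (suc (suc n) ∷ a) .(suc (suc n) ∷ a ++ k ∷ []) k w w' k≤1 refl =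
        trans (fwd-track n (a ++ k ∷ []) p) (cong (_++ k ∷ []) (sym (fwd-track n a p)))
        where p = seqTree-dom {F} n a w

    seq-≅-reindex : seqTree O F ≅ seqTree O G
    seq-≅-reindex = PosIso⇒≅ record
      { fwd = fwd ; bwd = bwd ; fwd-supp = fwd-supp ; bwd-supp = bwd-supp ; bwd∘fwd = bwd∘fwd
      ; fwd∘bwd = fwd∘bwd ; label = label ; mono = mono ; length≡ = length≡ ; step = step }

  open Pointwise using (seq-≅-pointwise) public
  open Reindex using (seq-≅-reindex) public

  famOver : {A : Set} (F : Fam A) → (Dom F → STy O) → SSeq O
  famOver F f n = onJust (F n) (λ p → just (f (n , p))) nothing

  famOver-dom : {A : Set} (F : Fam A) (f : Dom F → STy O) → ∀ n → Is-just (famOver F f n) → Is-just (F n)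
  famOver-dom F f n = onJust-Is-just Is-just (F n) ¬Is-just-nothing

  famOver-dom⁻¹ : {A : Set} (F : Fam A) (f : Dom F → STy O) → ∀ n → Is-just (F n) → Is-just (famOver F f n)
  famOver-dom⁻¹ F f n p = subst Is-just (sym (onJust-just _ nothing p)) (just tt)

  famOver-elt : {A : Set} (F : Fam A) (f : Dom F → STy O) → ∀ n (p : Is-just (F n)) (q : Is-just (famOver F f n)) →
                to-witness q ≡ f (n , p)
  famOver-elt F f n p q = to-witness-cong (onJust-just _ nothing p) q (just tt)

  famOver-bij : {A : Set} (F : Fam A) (f : Dom F → STy O) → Bij (Dom (famOver F f)) (Dom F)
  famOver-bij F f = record
    { to      = λ (n , q) → n , famOver-dom F f n q
    ; from    = λ (n , p) → n , famOver-dom⁻¹ F f n p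
    ; from∘to = λ _ → Σ-Is-just-≡ refl
    ; to∘from = λ _ → Σ-Is-just-≡ refl }

  -- First replace each element of F by its match in G on the same index set, then reindex.
  Match⇒seq-≅ : ∀ {F G : SSeq O} → Match (_≈_ O) (elt F) (elt G) → seqTree O F ≅ seqTree O G
  Match⇒seq-≅ {F} {G} m = ≅-trans (seq-≅-pointwise (famOver-dom⁻¹ F g) (famOver-dom F g) Ψ)
                                   (seq-≅-reindex {H} ρH (λ (n , q) → sym (famOver-elt F g n (famOver-dom F g n q) q)))
    where
      open Bij (Match.bij m)
      g : Dom F → STy O
      g k = elt G (to k)
      H = famOver F g
      Ψ : ∀ n (p : Is-just (F n)) (q : Is-just (H n)) → lab (to-witness p) ≅ lab (to-witness q)
      Ψ n p q = ≅-trans (Match.rel m (n , p)) (≅-reflexive (λ a → cong (λ S → lab S a) (sym (famOver-elt F g n p q))))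
      ρH : Bij (Dom H) (Dom G)
      ρH = record
        { to      = λ k → to (Bij.to (famOver-bij F g) k)
        ; from    = λ k → Bij.from (famOver-bij F g) (from k)
        ; from∘to = λ k → Σ-Is-just-≡ (cong proj₁ (from∘to (Bij.to (famOver-bij F g) k)))
        ; to∘from = λ k → trans (cong to (Σ-Is-just-≡ refl)) (to∘from k) }

-- Matchings of families of S-types

Bij-trans : ∀ {I J K : Set} → Bij I J → Bij J K → Bij I K
Bij-trans b c = record
  { to      = λ i → C.to (B.to i)
  ; from    = λ k → B.from (C.from k)
  ; from∘to = λ i → trans (cong B.from (C.from∘to (B.to i))) (B.from∘to i)
  ; to∘from = λ k → trans (cong C.to (B.to∘from (C.from k))) (C.to∘from k) }
  where module B = Bij b
        module C = Bij c

Bij-sym : ∀ {I J : Set} → Bij I J → Bij J I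
Bij-sym b = record { to = from ; from = to ; from∘to = to∘from ; to∘from = from∘to }
  where open Bij b

Bij-empty : ∀ {I J : Set} → ¬ I → ¬ J → Bij I J
Bij-empty ¬i ¬j = record
  { to = λ i → ⊥-elim (¬i i) ; from = λ j → ⊥-elim (¬j j)
  ; from∘to = λ i → ⊥-elim (¬i i) ; to∘from = λ j → ⊥-elim (¬j j) }

module _ {O : Set} where

  ≡⇒≈ : ∀ {S S' : STy O} → S ≡ S' → _≈_ O S S'
  ≡⇒≈ refl = ≅-reflexive (λ _ → refl)

  ≈-sym : ∀ {S S' : STy O} → _≈_ O S S' → _≈_ O S' S
  ≈-sym {S} {S'} = ≅-sym (STy-wellShaped S) (STy-wellShaped S')

  _≋_ : {I J : Set} → (I → STy O) → (J → STy O) → Set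
  f ≋ g = Match (_≈_ O) f g

  Bij⇒≋ : ∀ {I J : Set} {f : I → STy O} {g : J → STy O} (b : Bij I J) →
          (∀ i → g (Bij.to b i) ≡ f i) → f ≋ g
  Bij⇒≋ b e = record { bij = b ; rel = λ i → ≡⇒≈ (sym (e i)) }

  ≋-trans : ∀ {I J K : Set} {f : I → STy O} {g : J → STy O} {h : K → STy O} → f ≋ g → g ≋ h → f ≋ h
  ≋-trans m m' = record
    { bij = Bij-trans (Match.bij m) (Match.bij m')
    ; rel = λ i → ≅-trans (Match.rel m i) (Match.rel m' (Bij.to (Match.bij m) i)) }

  ≋-sym : ∀ {I J : Set} {f : I → STy O} {g : J → STy O} → f ≋ g → g ≋ f
  ≋-sym {f = f} {g} m = record { bij = Bij-sym (Match.bij m) ; rel = rel }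
    where
      open Bij (Match.bij m)
      rel : ∀ j → _≈_ O (g j) (f (from j))
      rel j = ≅-trans (≡⇒≈ (cong g (sym (to∘from j)))) (≈-sym {f (from j)} {g (to (from j))} (Match.rel m (from j)))

  ≋-empty : ∀ {I J : Set} {f : I → STy O} {g : J → STy O} → ¬ I → ¬ J → f ≋ g
  ≋-empty ¬i ¬j = record { bij = Bij-empty ¬i ¬j ; rel = λ i → ⊥-elim (¬i i) }

  ≋-pointwise : ∀ {F G : Fam (STy O)} → (∀ n → F n ≡ G n) → elt F ≋ elt G
  ≋-pointwise e = record
    { bij = record { to      = λ (n , p) → n , subst Is-just (e n) p
                   ; from    = λ (n , q) → n , subst Is-just (sym (e n)) q
                   ; from∘to = λ _ → Σ-Is-just-≡ refl
                   ; to∘from = λ _ → Σ-Is-just-≡ refl }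
    ; rel = λ (n , p) → ≡⇒≈ (to-witness-cong (e n) p (subst Is-just (e n) p)) }

  ≋-sum : ∀ {I : Set} {G G' : RMult O} {D D' : I → RMult O} →
          elt G ≋ elt G' → (∀ i → elt (D i) ≋ elt (D' i)) → sumElt O G D ≋ sumElt O G' D'
  ≋-sum {I} {G} {G'} {D} {D'} m ms = record { bij = b ; rel = rel }
    where
      module B = Bij (Match.bij m)
      module Bs i = Bij (Match.bij (ms i))
      to : SumIdx O G D → SumIdx O G' D'
      to (inj₁ a)       = inj₁ (B.to a)
      to (inj₂ (i , a)) = inj₂ (i , Bs.to i a)
      from : SumIdx O G' D' → SumIdx O G D
      from (inj₁ a)       = inj₁ (B.from a)
      from (inj₂ (i , a)) = inj₂ (i , Bs.from i a)
      from∘to : ∀ x → from (to x) ≡ x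
      from∘to (inj₁ a)       = cong inj₁ (B.from∘to a)
      from∘to (inj₂ (i , a)) = cong (λ z → inj₂ (i , z)) (Bs.from∘to i a)
      to∘from : ∀ x → to (from x) ≡ x
      to∘from (inj₁ a)       = cong inj₁ (B.to∘from a)
      to∘from (inj₂ (i , a)) = cong (λ z → inj₂ (i , z)) (Bs.to∘from i a)
      b : Bij (SumIdx O G D) (SumIdx O G' D')
      b = record { to = to ; from = from ; from∘to = from∘to ; to∘from = to∘from }
      rel : ∀ x → _≈_ O (sumElt O G D x) (sumElt O G' D' (to x))
      rel (inj₁ a)       = Match.rel m a
      rel (inj₂ (i , a)) = Match.rel (ms i) a

-- Coding positions as tracks

-- A position is written in bijective base 2, each letter n as n digits 2 followed by one digit 1.
unary : ℕ → ℕᵇ → ℕᵇ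
unary zero    b = b
unary (suc n) b = 2[1+ unary n b ]

encode : Pos → ℕᵇ
encode []      = ℕᵇ.zero
encode (n ∷ a) = unary n 1+[2 encode a ]

incHead : Pos → Pos
incHead []      = []
incHead (n ∷ a) = suc n ∷ a

decodeᵇ : ℕᵇ → Pos
decodeᵇ ℕᵇ.zero  = []
decodeᵇ 2[1+ b ] = incHead (decodeᵇ b)
decodeᵇ 1+[2 b ] = 0 ∷ decodeᵇ b

decodeᵇ-unary : ∀ n b → decodeᵇ (unary n 1+[2 b ]) ≡ n ∷ decodeᵇ b
decodeᵇ-unary zero    b = refl
decodeᵇ-unary (suc n) b = cong incHead (decodeᵇ-unary n b)

decodeᵇ-encode : ∀ a → decodeᵇ (encode a) ≡ a
decodeᵇ-encode []      = refl
decodeᵇ-encode (n ∷ a) = trans (decodeᵇ-unary n (encode a)) (cong (n ∷_) (decodeᵇ-encode a))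

code : Pos → ℕ
code a = toℕ (encode a)

decode : ℕ → Pos
decode j = decodeᵇ (fromℕ j)

decode-code : ∀ a → decode (code a) ≡ a
decode-code a = trans (cong decodeᵇ (fromℕ-toℕ (encode a))) (decodeᵇ-encode a)

letterAfter : Pos → Pos → Maybe ℕ
letterAfter []      []      = nothing
letterAfter []      (h ∷ _) = just h
letterAfter (_ ∷ _) []      = nothing
letterAfter (x ∷ w) (y ∷ l) with x ≟ y
... | yes _ = letterAfter w l
... | no  _ = nothing

letterAfter-++ : ∀ w h r → letterAfter w (w ++ h ∷ r) ≡ just h
letterAfter-++ []      h r = refl
letterAfter-++ (x ∷ w) h r with x ≟ x
... | yes _ = letterAfter-++ w h r
... | no  x≢x = ⊥-elim (x≢x refl)

letterAfter-⊑ : ∀ w l h → (w ++ h ∷ []) ⊑ l → letterAfter w l ≡ just h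
letterAfter-⊑ w l h (c , e) = subst (λ z → letterAfter w z ≡ just h) (trans (sym (++-assoc w (h ∷ []) c)) e) (letterAfter-++ w h c)

letterAfter⇒⊑ : ∀ w l h → letterAfter w l ≡ just h → w ⊑ l
letterAfter⇒⊑ []      l       h e = l , refl
letterAfter⇒⊑ (x ∷ w) (y ∷ l) h e with x ≟ y
... | yes refl = let (c , e') = letterAfter⇒⊑ w l h e in c , cong (x ∷_) e'
letterAfter⇒⊑ (x ∷ w) (y ∷ l) h () | no _

-- S-contexts

module _ {O : Set} where

  singleton : Var → ℕ → STy O → SCtx O
  singleton x k σ y j with y ≟ x | j ≟ k
  ... | yes _ | yes _ = just σ
  ... | _     | _     = nothing

  singleton-at : ∀ x k σ → singleton x k σ x k ≡ just σ
  singleton-at x k σ with x ≟ x | k ≟ k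
  ... | yes _   | yes _   = refl
  ... | no x≢x  | _       = ⊥-elim (x≢x refl)
  ... | yes _   | no k≢k  = ⊥-elim (k≢k refl)

  singleton-supp : ∀ x k σ y j → Is-just (singleton x k σ y j) → y ≡ x × j ≡ k
  singleton-supp x k σ y j p with y ≟ x | j ≟ k
  ... | yes y≡x | yes j≡k = y≡x , j≡k

  singleton-elt : ∀ x k σ y j (p : Is-just (singleton x k σ y j)) → to-witness p ≡ σ
  singleton-elt x k σ y j p with y ≟ x | j ≟ k
  ... | yes _ | yes _ = to-witness-cong refl p (just tt)

  delete : Var → SCtx O → SCtx O
  delete x C y with y ≟ x
  ... | yes _ = λ _ → nothing
  ... | no  _ = C y

  delete-at : ∀ x C j → delete x C x j ≡ nothing
  delete-at x C j with x ≟ x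
  ... | yes _  = refl
  ... | no x≢x = ⊥-elim (x≢x refl)

  delete-other : ∀ x C y → y ≢ x → ∀ j → delete x C y j ≡ C y j
  delete-other x C y y≢x j with y ≟ x
  ... | yes y≡x = ⊥-elim (y≢x y≡x)
  ... | no  _   = refl

  pick : Maybe ℕ → Maybe (STy O) → (ℕ → Maybe (STy O)) → Maybe (STy O)
  pick nothing        c d = nothing
  pick (just zero)    c d = c
  pick (just (suc n)) c d = d n

  pick-just : ∀ m c d → Is-just (pick m c d) → Σ ℕ (λ h → m ≡ just h)
  pick-just (just h) c d p = h , refl

  -- Gluing the context c of the function premise with the contexts d n
  -- of the argument premises: select j says whose track j is
  -- (just 0 for the function, just (suc n) for argument n).
  module Glue (select : ℕ → Maybe ℕ) (c : ℕ → Maybe (STy O)) (d : ℕ → ℕ → Maybe (STy O))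
              (c-sel : ∀ j → Is-just (c j) → select j ≡ just 0)
              (d-sel : ∀ n j → Is-just (d n j) → select j ≡ just (suc n)) where

    glued : ℕ → Maybe (STy O)
    glued j = pick (select j) (c j) (λ n → d n j)

    private
      c-off : ∀ j → select j ≢ just 0 → c j ≡ nothing
      c-off j ne = ¬Is-just⇒nothing (c j) (λ p → ne (c-sel j p))

      d-off : ∀ n j → select j ≢ just (suc n) → d n j ≡ nothing
      d-off n j ne = ¬Is-just⇒nothing (d n j) (λ p → ne (d-sel n j p))

      just-suc-injective : ∀ {m : Maybe ℕ} {n n' : ℕ} → m ≡ just (suc n) → m ≡ just (suc n') → n ≡ n'
      just-suc-injective refl refl = refl

      select≢ : ∀ {j} {m m' : Maybe ℕ} → select j ≡ m → m ≢ m' → select j ≢ m'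
      select≢ es m≢m' e = m≢m' (trans (sym es) e)

    glued-union : ∀ {A : SSeq O} → (∀ n j → Is-just (d n j) → Is-just (A n)) →
                  ∀ j → UnionAt O (glued j) (c j) A (λ n → d n j)
    glued-union {A} d⊆A j with select j in es
    ... | nothing      = fromC (sym (c-off j (select≢ es λ ()))) (λ k → d-off (proj₁ k) j (select≢ es λ ()))
    ... | just zero    = fromC refl (λ k → d-off (proj₁ k) j (select≢ es λ ()))
    ... | just (suc n) with d n j in ed
    ...   | nothing = fromC (sym (c-off j (select≢ es λ ())))
                            (λ k → ¬Is-just⇒nothing (d (proj₁ k) j) (λ p → ¬Is-just-nothing (subst Is-just ed
                                     (subst Is-just (cong (λ m → d m j) (just-suc-injective (d-sel (proj₁ k) j p) es)) p))))
    ...   | just _  = fromD (c-off j (select≢ es λ ())) (n , d⊆A n j (subst Is-just (sym ed) (just tt)))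
                            ed (just tt) (λ k' ne → d-off (proj₁ k') j (λ e → ne (just-suc-injective e es)))

    Parts : Set
    Parts = Dom c ⊎ Σ ℕ (λ n → Dom (d n))

    partElt : Parts → STy O
    partElt (inj₁ k)       = elt c k
    partElt (inj₂ (n , k)) = elt (d n) k

    private
      toPart : ∀ j m → Is-just (pick m (c j) (λ n → d n j)) → Parts
      toPart j (just zero)    p = inj₁ (j , p)
      toPart j (just (suc n)) p = inj₂ (n , (j , p))

      fromPart : Parts → Dom glued
      fromPart (inj₁ (j , p))       = j , subst (λ m → Is-just (pick m (c j) (λ n → d n j))) (sym (c-sel j p)) p
      fromPart (inj₂ (n , (j , p))) = j , subst (λ m → Is-just (pick m (c j) (λ n → d n j))) (sym (d-sel n j p)) p

      fromPart-toPart : ∀ j m p → proj₁ (fromPart (toPart j m p)) ≡ j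
      fromPart-toPart j (just zero)    p = refl
      fromPart-toPart j (just (suc n)) p = refl

      toPart-c : ∀ j m p (q : Is-just (c j)) → m ≡ just 0 → toPart j m p ≡ inj₁ (j , q)
      toPart-c j .(just 0) p q refl = cong (λ z → inj₁ (j , z)) (Is-just-irrelevant p q)

      toPart-d : ∀ j n m p (q : Is-just (d n j)) → m ≡ just (suc n) → toPart j m p ≡ inj₂ (n , (j , q))
      toPart-d j n .(just (suc n)) p q refl = cong (λ z → inj₂ (n , (j , z))) (Is-just-irrelevant p q)

      elt-toPart : ∀ j m p → to-witness p ≡ partElt (toPart j m p)
      elt-toPart j (just zero)    p = refl
      elt-toPart j (just (suc n)) p = refl

    glued-parts : Bij (Dom glued) Parts
    glued-parts = record
      { to      = λ (j , p) → toPart j (select j) p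
      ; from    = fromPart
      ; from∘to = λ (j , p) → Σ-Is-just-≡ (fromPart-toPart j (select j) p)
      ; to∘from = λ { (inj₁ (j , q))       → toPart-c j (select j) _ q (c-sel j q)
                    ; (inj₂ (n , (j , q))) → toPart-d j n (select j) _ q (d-sel n j q) } }

    glued-elt : ∀ k → elt glued k ≡ partElt (Bij.to glued-parts k)
    glued-elt (j , p) = elt-toPart j (select j) p

-- Lifting R-derivations

module _ {O : Set} where

  subtree : (U : STy O) (k : ℕ) → Is-just (lab U (k ∷ [])) → STy O
  subtree U k p = record
    { lab = λ a → lab U (k ∷ a)
    ; wf  = record { root   = p
                   ; parent = λ a → IsSTy.parent (wf U) (k ∷ a)
                   ; no0    = λ a → IsSTy.no0 (wf U) (k ∷ a)
                   ; cod    = λ a → IsSTy.cod (wf U) (k ∷ a) } }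

  trackTree-onJust : ∀ {X : Set} (m : Maybe X) (g : Is-just m → STy O) (v : Maybe (Label O)) a →
                     (∀ p → lab (g p) a ≡ v) → (Is-just v → Is-just m) →
                     trackTree (onJust m (λ p → just (g p)) nothing) a ≡ v
  trackTree-onJust (just _) g v a e _ = e (just tt)
  trackTree-onJust nothing  g v a _ h = sym (¬Is-just⇒nothing v (λ q → ¬Is-just-nothing (h q)))

  module ArrowView (U : STy O) (root-arr : lab U [] ≡ just arrL) where
    codomain : STy O
    codomain = subtree U 1 (IsSTy.cod (wf U) [] root-arr)

    domain : SSeq O
    domain n = onJust (lab U (suc (suc n) ∷ [])) (λ p → just (subtree U (suc (suc n)) p)) nothing

    arrow-view : _≐_ O U (mkArr O domain codomain)
    arrow-view []                = root-arr
    arrow-view (zero ∷ a)        = ¬Is-just⇒nothing _ (λ p → IsSTy.no0 (wf U) [] (STy-prefix-closed U (0 ∷ []) a p))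
    arrow-view (suc zero ∷ a)    = refl
    arrow-view (suc (suc n) ∷ a) = sym (trans (seqTree-track domain n a)
      (trackTree-onJust (lab U (suc (suc n) ∷ [])) (subtree U (suc (suc n))) (lab U (suc (suc n) ∷ a)) a
                        (λ _ → refl) (STy-prefix-closed U (suc (suc n) ∷ []) a)))

  ≈-arrow-root : ∀ {U : STy O} {F : SSeq O} {T : STy O} → _≈_ O U (mkArr O F T) → lab U [] ≡ just arrL
  ≈-arrow-root {U} {F} {T} i = trans (sym (_≡ᵗ_.label i root))
                                     (cong (arrTree O F T) (length≡0 (pos O (Bij.to (_≡ᵗ_.φ i) root)) (_≡ᵗ_.lengthφ i root)))
    where root : Supp (lab U)
          root = [] , IsSTy.root (wf U)

  UsesTracksBelow : Pos → SCtx O → Set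
  UsesTracksBelow w C = ∀ x j → Is-just (C x j) → w ⊑ decode j

  record Lifting (w : Pos) {Γ : RCtx O} {t : Term} {τ : STy O} (Π : RDer O Γ t τ) : Set where
    constructor lifting
    field
      C         : SCtx O
      T         : STy O
      P         : SDer O C t T
      collapses : Collapse O P Π
      T≈τ       : _≈_ O T τ
      C≋Γ       : CtxColl O C Γ
      tracks    : UsesTracksBelow w C

  singleton-≋ : ∀ {G : RMult O} (b : Bij (Dom G) ⊤) x k →
                elt (singleton x k (elt G (Bij.from b tt)) x) ≋ elt G
  singleton-≋ {G} b x k = record
    { bij = record { to      = λ _ → from tt
                   ; from    = λ _ → k , subst Is-just (sym (singleton-at x k σ)) (just tt)
                   ; from∘to = λ (j , p) → Σ-Is-just-≡ (sym (proj₂ (singleton-supp x k σ x j p)))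
                   ; to∘from = from∘to }
    ; rel = λ (j , p) → ≡⇒≈ (singleton-elt x k σ x j p) }
    where open Bij b
          σ = elt G (from tt)

  lift-ax : ∀ w {Γ x τ} (m : Match (_≈_ O) (elt (Γ x)) (λ (_ : ⊤) → τ)) (Γ-only-x : ∀ y → y ≢ x → Dom (Γ y) → ⊥) →
            Lifting w (rax {Γ = Γ} {x} {τ} m Γ-only-x)
  lift-ax w {Γ} {x} {τ} m Γ-only-x = lifting C σ P (cax C≋Γ σ≈τ) σ≈τ C≋Γ tracks
    where
      open Bij (Match.bij m)
      σ = elt (Γ x) (from tt)
      σ≈τ = Match.rel m (from tt)
      C = singleton x (code w) σ
      P : SDer O C (var x) σ
      P = sax (code w) (singleton-at x (code w) σ)
              (λ j j≢k → ¬Is-just⇒nothing _ (λ p → j≢k (proj₂ (singleton-supp x _ σ x j p))))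
              (λ y y≢x j → ¬Is-just⇒nothing _ (λ p → y≢x (proj₁ (singleton-supp x _ σ y j p))))
      C≋Γ-at : ∀ y → Dec (y ≡ x) → elt (C y) ≋ elt (Γ y)
      C≋Γ-at y (yes refl) = singleton-≋ (Match.bij m) x (code w)
      C≋Γ-at y (no y≢x)   = ≋-empty (λ (j , p) → y≢x (proj₁ (singleton-supp x _ σ y j p))) (Γ-only-x y y≢x)
      C≋Γ : CtxColl O C Γ
      C≋Γ y = C≋Γ-at y (y ≟ x)
      tracks : UsesTracksBelow w C
      tracks y j p = subst (λ j → w ⊑ decode j) (sym (proj₂ (singleton-supp x _ σ y j p)))
                           (subst (w ⊑_) (sym (decode-code w)) (⊑-refl w))

  lift-abs : ∀ {w Γ Γ' x t τ U} {Π : RDer O Γ' t τ} (Γx-empty : Dom (Γ x) → ⊥)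
             (Γ≋Γ' : ∀ y → y ≢ x → _≅M_ O (Γ y) (Γ' y)) (U≈ : _≈_ O U (mkArr O (Γ' x) τ)) →
             Lifting w Π → Lifting w (rabs {Γ = Γ} {Γ'} {x} {t} {τ} {U} Π Γx-empty Γ≋Γ' U≈)
  lift-abs {w} {Γ} {Γ'} {x} {t} {τ} {U} Γx-empty Γ≋Γ' U≈ r =
    lifting C T P (cabs C≋Γ T≈U r.collapses) T≈U C≋Γ tracks
    where
      module r = Lifting r
      C = delete x r.C
      T = mkArr O (r.C x) r.T
      P : SDer O C (lam x t) T
      P = sabs r.P (delete-at x r.C) (delete-other x r.C)
      T≈U : _≈_ O T U
      T≈U = ≅-trans (arr-≅-cong r.T≈τ (Match⇒seq-≅ (r.C≋Γ x))) (≈-sym {S = U} {S' = mkArr O (Γ' x) τ} U≈)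
      C≋Γ-at : ∀ y → Dec (y ≡ x) → elt (C y) ≋ elt (Γ y)
      C≋Γ-at y (yes refl) = ≋-empty (λ (j , p) → ¬Is-just-nothing (subst Is-just (delete-at x r.C j) p)) Γx-empty
      C≋Γ-at y (no y≢x)   = ≋-trans (≋-pointwise (delete-other x r.C y y≢x))
                                    (≋-trans (r.C≋Γ y) (≋-sym (Γ≋Γ' y y≢x)))
      C≋Γ : CtxColl O C Γ
      C≋Γ y = C≋Γ-at y (y ≟ x)
      tracks-at : ∀ y j → Dec (y ≡ x) → Is-just (C y j) → w ⊑ decode j
      tracks-at y j (yes refl) p = ⊥-elim (¬Is-just-nothing (subst Is-just (delete-at x r.C j) p))
      tracks-at y j (no y≢x)   p = r.tracks y j (subst Is-just (delete-other x r.C y y≢x j) p)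
      tracks : UsesTracksBelow w C
      tracks y j = tracks-at y j (y ≟ x)

  Collapse-subst : ∀ {C C' : SCtx O} {t : Term} {T T' : STy O} {Γ : RCtx O} {τ : STy O} {Π : RDer O Γ t τ} →
                   C ≡ C' → T ≡ T' → (P : SDer O C t T) → Collapse O P Π →
                   Σ (SDer O C' t T') (λ P' → Collapse O P' Π)
  Collapse-subst refl refl P c = P , c

  Σ-Dom-≡ : ∀ {A : Set} {M : Fam A} {K : Dom M → Fam (STy O)} {n : ℕ} {p p' : Is-just (M n)} {j : ℕ}
            {r : Is-just (K (n , p) j)} {r' : Is-just (K (n , p') j)} →
            _≡_ {A = Σ (Dom M) (λ i → Dom (K i))} ((n , p) , (j , r)) ((n , p') , (j , r'))
  Σ-Dom-≡ {p = p} {p'} {r = r} {r'} with Is-just-irrelevant p p'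
  ... | refl = cong (λ z → (_ , _) , (_ , z)) (Is-just-irrelevant r r')

  module Application {w : Pos} {Γ E : RCtx O} {t u : Term} {U τ : STy O} {M : RMult O}
                     {Δ : Dom M → RCtx O} {Πf : RDer O Γ t U} (U≈ : _≈_ O U (mkArr O M τ))
                     {Πs : (i : Dom M) → RDer O (Δ i) u (elt M i)}
                     (sum≋E : ∀ x → Match (_≈_ O) (sumElt O (Γ x) (λ i → Δ i x)) (elt (E x)))
                     (fun : Lifting (w ++ 0 ∷ []) Πf)
                     (arg : (i : Dom M) → Lifting (w ++ suc (proj₁ i) ∷ []) (Πs i)) where
    private
      module fun = Lifting fun
      module arg i = Lifting (arg i)

      funTy≈ : _≈_ O fun.T (mkArr O M τ)
      funTy≈ = ≅-trans fun.T≈τ U≈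

    open ArrowView fun.T (≈-arrow-root {U = fun.T} funTy≈) public

    arrow≈ : _≈_ O (mkArr O domain codomain) (mkArr O M τ)
    arrow≈ = ≅-trans (≅-reflexive (λ a → sym (arrow-view a))) funTy≈

    A : SSeq O
    A = famOver M arg.T

    A≋M : elt A ≋ elt M
    A≋M = record { bij = famOver-bij M arg.T ; rel = rel }
      where rel : ∀ k → _≈_ O (elt A k) (elt M (Bij.to (famOver-bij M arg.T) k))
            rel (n , q) = ≅-trans (≡⇒≈ (famOver-elt M arg.T n p q)) (arg.T≈τ (n , p))
              where p = famOver-dom M arg.T n q

    domain≈A : _≈seq_ O domain A
    domain≈A = ≅-trans (arr-≅⇒seq-≅ arrow≈) (≅-sym (seqTree-wellShaped A) (seqTree-wellShaped M) (Match⇒seq-≅ A≋M))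

    D : ℕ → SCtx O
    D n = onJust (M n) (λ p → arg.C (n , p)) (λ _ _ → nothing)

    D-arg : ∀ n p → D n ≡ arg.C (n , p)
    D-arg n p = onJust-just _ _ p

    D-dom : ∀ n x j → Is-just (D n x j) → Is-just (M n)
    D-dom n x j = onJust-Is-just (λ C → Is-just (C x j)) (M n) {f = λ p → arg.C (n , p)} ¬Is-just-nothing

    D-arg-supp : ∀ n x j (r : Is-just (D n x j)) → Is-just (arg.C (n , D-dom n x j r) x j)
    D-arg-supp n x j r = subst (λ C → Is-just (C x j)) (D-arg n (D-dom n x j r)) r

    argDer : (k : Dom A) → Σ (SDer O (D (proj₁ k)) u (elt A k)) (λ P → Collapse O P (Πs (Bij.to (famOver-bij M arg.T) k)))
    argDer (n , q) = Collapse-subst (sym (D-arg n p)) (sym (famOver-elt M arg.T n p q)) (arg.P (n , p)) (arg.collapses (n , p))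
      where p = famOver-dom M arg.T n q

    select : ℕ → Maybe ℕ
    select j = letterAfter w (decode j)

    fun-select : ∀ x j → Is-just (fun.C x j) → select j ≡ just 0
    fun-select x j p = letterAfter-⊑ w (decode j) 0 (fun.tracks x j p)

    arg-select : ∀ x n j → Is-just (D n x j) → select j ≡ just (suc n)
    arg-select x n j r = letterAfter-⊑ w (decode j) (suc n) (arg.tracks (n , D-dom n x j r) x j (D-arg-supp n x j r))

    module G x = Glue select (fun.C x) (λ n j → D n x j) (fun-select x) (arg-select x)

    C : SCtx O
    C x = G.glued x

    P : SDer O C (app t u) codomain
    P = sapp A D fun.P arrow-view domain≈A (λ k → proj₁ (argDer k))
             (λ x → G.glued-union x (λ n j r → famOver-dom⁻¹ M arg.T n (D-dom n x j r)))

    parts-bij : ∀ x → Bij (G.Parts x) (SumIdx O (fun.C x) (λ i → arg.C i x))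
    parts-bij x = record { to = to ; from = from ; from∘to = from∘to ; to∘from = to∘from }
      where
        to : G.Parts x → SumIdx O (fun.C x) (λ i → arg.C i x)
        to (inj₁ a)             = inj₁ a
        to (inj₂ (n , (j , r))) = inj₂ ((n , D-dom n x j r) , (j , D-arg-supp n x j r))
        from : SumIdx O (fun.C x) (λ i → arg.C i x) → G.Parts x
        from (inj₁ a)                   = inj₁ a
        from (inj₂ ((n , p) , (j , r))) = inj₂ (n , (j , subst (λ C → Is-just (C x j)) (sym (D-arg n p)) r))
        from∘to : ∀ a → from (to a) ≡ a
        from∘to (inj₁ a)             = refl
        from∘to (inj₂ (n , (j , r))) = cong (λ z → inj₂ (n , z)) (Σ-Is-just-≡ refl)
        to∘from : ∀ a → to (from a) ≡ a
        to∘from (inj₁ a)                   = refl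
        to∘from (inj₂ ((n , p) , (j , r))) = cong inj₂ (Σ-Dom-≡ {K = λ i → arg.C i x})

    parts-elt : ∀ x a → sumElt O (fun.C x) (λ i → arg.C i x) (Bij.to (parts-bij x) a) ≡ G.partElt x a
    parts-elt x (inj₁ a)             = refl
    parts-elt x (inj₂ (n , (j , r))) = to-witness-cong (cong (λ C → C x j) (sym (D-arg n (D-dom n x j r)))) (D-arg-supp n x j r) r

    C≋E : CtxColl O C E
    C≋E x = ≋-trans (Bij⇒≋ (Bij-trans (G.glued-parts x) (parts-bij x))
                            (λ k → trans (parts-elt x (Bij.to (G.glued-parts x) k)) (sym (G.glued-elt x k))))
                    (≋-trans (≋-sum (fun.C≋Γ x) (λ i → arg.C≋Γ i x)) (sum≋E x))

    tracks : UsesTracksBelow w C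
    tracks x j p = let (h , e) = pick-just (select j) _ _ p in letterAfter⇒⊑ w (decode j) h e

  lift-app : ∀ {w : Pos} {Γ E : RCtx O} {t u : Term} {U τ : STy O} (M : RMult O) (Δ : Dom M → RCtx O) {Πf : RDer O Γ t U}
             (U≈ : _≈_ O U (mkArr O M τ)) (Πs : (i : Dom M) → RDer O (Δ i) u (elt M i))
             (sum≋E : ∀ x → Match (_≈_ O) (sumElt O (Γ x) (λ i → Δ i x)) (elt (E x))) →
             Lifting (w ++ 0 ∷ []) Πf → ((i : Dom M) → Lifting (w ++ suc (proj₁ i) ∷ []) (Πs i)) →
             Lifting w (rapp M Δ Πf U≈ Πs sum≋E)
  lift-app M Δ U≈ Πs sum≋E fun arg =
    lifting C codomain P (capp C≋E cod≈τ (Lifting.collapses fun) (famOver-bij M (λ i → Lifting.T (arg i))) (λ k → proj₂ (argDer k)))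
            cod≈τ C≋E tracks
    where open Application U≈ sum≋E fun arg
          cod≈τ = arr-≅⇒cod-≅ arrow≈

  lift : ∀ (w : Pos) {Γ : RCtx O} {t : Term} {τ : STy O} (Π : RDer O Γ t τ) → Lifting w Π
  lift w (rax m Γ-only-x)             = lift-ax w m Γ-only-x
  lift w (rabs Π Γx-empty Γ≋Γ' U≈)    = lift-abs Γx-empty Γ≋Γ' U≈ (lift w Π)
  lift w (rapp M Δ Πf U≈ Πs sum≋E)    =
    lift-app M Δ {Πf} U≈ Πs sum≋E (lift (w ++ 0 ∷ []) Πf) (λ i → lift (w ++ suc (proj₁ i) ∷ []) (Πs i))

mainTheorem4 : (O : Set) {Γ : RCtx O} {t : Term} {τ : STy O} (Π : RDer O Γ t τ) →
    Σ (SCtx O) (λ C → Σ (STy O) (λ T → Σ (SDer O C t T) (λ P → Collapse O P Π)))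
mainTheorem4 O Π = C , T , P , collapses
  where open Lifting (lift [] Π)
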